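{- Let $M_1=(E,\mathcal{B}_1)$ and $M_2=(E,\mathcal{B}_2)$ be matroids of the same rank $r$ on the same ground set $E$. If $Q(M_1)\cap Q(M_2)$ is a nonempty common face of $Q(M_1)$ and $Q(M_2)$, then $M_1\cap M_2:=(E,\mathcal{B}_1\cap\mathcal{B}_2)$ is a matroid of rank $r$ and $Q(M_1\cap M_2)=Q(M_1)\cap Q(M_2)$.
   Context: For a matroid $M$ on $E$ with bases $\mathcal{B}(M)$, the matroid base polytope is $Q(M)=\mathrm{conv}\{\sum_{i\in B}e_i: B\in\mathcal{B}(M)\}\subset\mathbb{R}^E$, where $e_i$ are the standard basis vectors.
   Formalization: The polytopes $Q(M)$ consist of points of ℚ^E rather than $\mathbb{R}^E$, and the normals and right-hand sides of the valid inequalities defining faces are rational. -}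

module Defs where

open import Data.Nat using (ℕ; zero; suc)
open import Data.Bool using (if_then_else_)
open import Data.Fin using (Fin; zero; suc)
open import Data.Fin.Subset using (Subset; _∈_; _∉_; _-_; _∪_; ⁅_⁆; ∣_∣)
open import Data.Vec using (lookup)
open import Data.Rational using (ℚ; 0ℚ; 1ℚ; _+_; _*_; _≤_)
open import Data.List using (List; []; _∷_; map)
open import Data.List.Relation.Unary.All using (All)
open import Data.Product using (Σ; ∃; ∃-syntax; _×_; _,_; proj₁; proj₂)
open import Relation.Binary.PropositionalEquality using (_≡_)

Family : ℕ → Set₁
Family n = Subset n → Set

record IsMatroid {n : ℕ} (𝓑 : Family n) : Set where
  field
    nonempty : ∃[ B ] 𝓑 B
    exchange : ∀ B₁ B₂ → 𝓑 B₁ → 𝓑 B₂ → ∀ x → x ∈ B₁ → x ∉ B₂ →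
               ∃[ y ] (y ∈ B₂ × y ∉ B₁ × 𝓑 ((B₁ - x) ∪ ⁅ y ⁆))

IsMatroidOfRank : {n : ℕ} → ℕ → Family n → Set
IsMatroidOfRank r 𝓑 = IsMatroid 𝓑 × (∀ B → 𝓑 B → ∣ B ∣ ≡ r)

_∩𝓑_ : {n : ℕ} → Family n → Family n → Family n
(𝓑₁ ∩𝓑 𝓑₂) B = 𝓑₁ B × 𝓑₂ B

Point : ℕ → Set
Point n = Fin n → ℚ

Σᶠ : {n : ℕ} → (Fin n → ℚ) → ℚ
Σᶠ {zero}  f = 0ℚ
Σᶠ {suc n} f = f zero + Σᶠ (λ i → f (suc i))

_·_ : {n : ℕ} → Point n → Point n → ℚ
c · x = Σᶠ (λ i → c i * x i)

χ : {n : ℕ} → Subset n → Point n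
χ B i = if lookup B i then 1ℚ else 0ℚ

Σˡ : List ℚ → ℚ
Σˡ [] = 0ℚ
Σˡ (q ∷ qs) = q + Σˡ qs

-- Matroid base polytope Q(𝓑) = conv{ e_B : B ∈ 𝓑 }, as a predicate on
-- rational points: x is a convex combination of finitely many e_B.
InQ : {n : ℕ} → Family n → Point n → Set
InQ {n} 𝓑 x =
  ∃[ ws ] ( All (λ p → 0ℚ ≤ proj₁ p × 𝓑 (proj₂ p)) ws
          × Σˡ (map proj₁ ws) ≡ 1ℚ
          × (∀ i → x i ≡ Σˡ (map (λ p → proj₁ p * χ (proj₂ p) i) ws)) )

_≐_ : {n : ℕ} → (Point n → Set) → (Point n → Set) → Set
P ≐ R = ∀ x → (P x → R x) × (R x → P x)

_∩ᴾ_ : {n : ℕ} → (Point n → Set) → (Point n → Set) → (Point n → Set)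
(P ∩ᴾ R) x = P x × R x

IsFace : {n : ℕ} → (Point n → Set) → (Point n → Set) → Set
IsFace {n} F P =
  ∃[ c ] ∃[ d ] ( (∀ x → P x → c · x ≤ d)
                × (F ≐ (λ x → P x × c · x ≡ d)) )

{-# OPTIONS --safe #-}
-- Let c · x ≤ d cut out the face F = Q(M₁) ∩ Q(M₂) of Q(M₁). A 0/1 point is a
-- convex combination of 0/1 points only trivially, so e_B lies in Q(M₂) iff B is a
-- basis of M₂; hence the common bases are exactly the bases of M₁ of maximal weight
-- c · e_B = d. Maximal-weight bases of a matroid satisfy basis exchange. Finally, in a
-- convex combination of vertices of Q(M₁) that lies on F, every vertex with positive
-- weight lies on F, i.e. comes from a common basis. Only the face condition in
-- Q(M₁) is used.
module Submission where

open import Defs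
open import Data.Nat using (ℕ)
open import Data.Nat using (zero; suc)
open import Data.Product using (∃-syntax; _×_)

open import Data.Bool using (Bool; true; false; if_then_else_)
open import Data.Empty using (⊥-elim)
open import Data.Fin using (Fin; zero; suc; _≟_)
open import Data.Fin.Subset using (Subset; _∈_; _∉_; _-_; _─_; _∪_; ⁅_⁆; ∣_∣; _⊆_; _⊂_; inside; outside)
open import Data.Fin.Subset.Properties
  using (_∈?_; drop-there; x∈⁅x⁆; x∈⁅y⁆⇒x≡y; x∉⁅y⁆⇒x≢y; x≢y⇒x∉⁅y⁆; x∈p∪q⁺; x∈p∪q⁻; x∈p∧x∉q⇒x∈p─q;
         x∈p∧x≢y⇒x∈p-y; p⊂q⇒∣p∣<∣q∣)
open import Data.List using (List; []; _∷_; map; filter; allFin)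
open import Data.List.Membership.Propositional using () renaming (_∈_ to _∈ˡ_)
open import Data.List.Membership.Propositional.Properties using (∈-filter⁺; ∈-allFin)
open import Data.List.Relation.Unary.All as All using (All; []; _∷_)
open import Data.List.Relation.Unary.All.Properties using (all-filter)
open import Data.List.Relation.Unary.Any using (here; there)
open import Data.Nat.Induction using (<-wellFounded)
open import Data.Product using (∃; _,_; proj₁; proj₂; map₂)
open import Data.Rational using (ℚ; 0ℚ; 1ℚ; _+_; _*_; _≤_; _<_; positive; nonNegative)
open import Data.Rational.Properties hiding (_≟_)
open import Data.Rational.Solver using (module +-*-Solver)
open import Data.Sum using (_⊎_; inj₁; inj₂)
open import Data.Vec using (_∷_; lookup; tabulate; here; there)
open import Data.Vec.Properties using (tabulate∘lookup; tabulate-cong; []=⇒lookup; lookup⇒[]=)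
open import Function using (_∘_; _⇔_; mk⇔; Equivalence)
open import Induction.WellFounded using (Acc; acc)
open import Relation.Binary using (DecTotalOrder)
open import Relation.Binary.PropositionalEquality
  using (_≡_; _≢_; refl; sym; trans; cong; cong₂; subst; module ≡-Reasoning)
open import Relation.Nullary using (yes; no; ¬?; _×-dec_)
open import Relation.Unary using (Decidable)

open import Data.List.Extrema (DecTotalOrder.totalOrder ≤-decTotalOrder)
  using (argmin; argmin-all; f[argmin]≤f[xs])
open +-*-Solver using (solve; _:+_; _:*_; _:=_)

private
  variable
    n : ℕ

0≤1 : 0ℚ ≤ 1ℚ
0≤1 = <⇒≤ (positive⁻¹ 1ℚ)

+-cancelˡ-≤ : ∀ r {p q : ℚ} → r + p ≤ r + q → p ≤ q
+-cancelˡ-≤ r r+p≤r+q = ≮⇒≥ λ q<p → <-irrefl refl (<-≤-trans (+-monoʳ-< r q<p) r+p≤r+q)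

+-cancelʳ-≤ : ∀ r {p q : ℚ} → p + r ≤ q + r → p ≤ q
+-cancelʳ-≤ r p+r≤q+r = ≮⇒≥ λ q<p → <-irrefl refl (<-≤-trans (+-monoˡ-< r q<p) p+r≤q+r)

+-mono-≤-≡⇒≡ : ∀ {p q r s : ℚ} → p ≤ q → r ≤ s → p + r ≡ q + s → p ≡ q × r ≡ s
+-mono-≤-≡⇒≡ p≤q r≤s eq =
  ≤-antisym p≤q (≮⇒≥ λ p<q → <⇒≢ (+-mono-<-≤ p<q r≤s) eq) ,
  ≤-antisym r≤s (≮⇒≥ λ r<s → <⇒≢ (+-mono-≤-< p≤q r<s) eq)

*-cancelˡ-≡-pos : ∀ {r p q : ℚ} → 0ℚ < r → r * p ≡ r * q → p ≡ q
*-cancelˡ-≡-pos {r} 0<r eq = ≤-antisym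
  (*-cancelˡ-≤-pos r {{positive 0<r}} (≤-reflexive eq))
  (*-cancelˡ-≤-pos r {{positive 0<r}} (≤-reflexive (sym eq)))

module _ {X : Set} (w : X → ℚ) where

  weighted : (X → ℚ) → List X → ℚ
  weighted a ps = Σˡ (map (λ p → w p * a p) ps)

  weighted-mono : ∀ a b ps → All (λ p → 0ℚ ≤ w p × a p ≤ b p) ps →
                  weighted a ps ≤ weighted b ps
  weighted-mono a b []       []                  = ≤-refl
  weighted-mono a b (p ∷ ps) ((0≤w , a≤b) ∷ hs) =
    +-mono-≤ (*-monoˡ-≤-nonNeg (w p) {{nonNegative 0≤w}} a≤b) (weighted-mono a b ps hs)

  weighted-≡⇒≡ : ∀ a b ps → All (λ p → 0ℚ ≤ w p × a p ≤ b p) ps →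
                 weighted a ps ≡ weighted b ps → All (λ p → 0ℚ < w p → a p ≡ b p) ps
  weighted-≡⇒≡ a b []       []                  _  = []
  weighted-≡⇒≡ a b (p ∷ ps) ((0≤w , a≤b) ∷ hs) eq =
    let head≡ , tail≡ = +-mono-≤-≡⇒≡ (*-monoˡ-≤-nonNeg (w p) {{nonNegative 0≤w}} a≤b)
                                      (weighted-mono a b ps hs) eq
    in (λ 0<w → *-cancelˡ-≡-pos 0<w head≡) ∷ weighted-≡⇒≡ a b ps hs tail≡

  weighted-const : ∀ k ps → Σˡ (map w ps) ≡ 1ℚ → weighted (λ _ → k) ps ≡ k
  weighted-const k ps Σw≡1 = trans (factor-out ps) (trans (cong (_* k) Σw≡1) (*-identityˡ k))
    where
    factor-out : ∀ ps → weighted (λ _ → k) ps ≡ Σˡ (map w ps) * k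
    factor-out []       = sym (*-zeroˡ k)
    factor-out (p ∷ ps) = trans (cong (w p * k +_) (factor-out ps)) (sym (*-distribʳ-+ k (w p) _))

  weighted-attains-max : ∀ a k ps → All (λ p → 0ℚ ≤ w p × a p ≤ k) ps → Σˡ (map w ps) ≡ 1ℚ →
                         weighted a ps ≡ k → All (λ p → 0ℚ < w p → a p ≡ k) ps
  weighted-attains-max a k ps bounds Σw≡1 eq =
    weighted-≡⇒≡ a (λ _ → k) ps bounds (trans eq (sym (weighted-const k ps Σw≡1)))

  weighted-attains-min : ∀ a k ps → All (λ p → 0ℚ ≤ w p × k ≤ a p) ps → Σˡ (map w ps) ≡ 1ℚ →
                         weighted a ps ≡ k → All (λ p → 0ℚ < w p → a p ≡ k) ps
  weighted-attains-min a k ps bounds Σw≡1 eq =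
    All.map (λ k≡a 0<w → sym (k≡a 0<w))
      (weighted-≡⇒≡ (λ _ → k) a ps bounds (trans (weighted-const k ps Σw≡1) (sym eq)))

  positive-weight : ∀ ps → All (λ p → 0ℚ ≤ w p) ps → Σˡ (map w ps) ≡ 1ℚ →
                    ∃[ p ] (p ∈ˡ ps × 0ℚ < w p)
  positive-weight []       []           ()
  positive-weight (p ∷ ps) (0≤w ∷ hs) Σw≡1 with 0ℚ <? w p
  ... | yes 0<w = p , here refl , 0<w
  ... | no  0≮w =
    let q , q∈ps , 0<wq = positive-weight ps hs tail-sum in q , there q∈ps , 0<wq
    where
    tail-sum : Σˡ (map w ps) ≡ 1ℚ
    tail-sum = begin
      Σˡ (map w ps)        ≡⟨ +-identityˡ _ ⟨
      0ℚ + Σˡ (map w ps)   ≡⟨ cong (_+ Σˡ (map w ps)) (≤-antisym 0≤w (≮⇒≥ 0≮w)) ⟩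
      w p + Σˡ (map w ps)  ≡⟨ Σw≡1 ⟩
      1ℚ                   ∎
      where open ≡-Reasoning

·-congˡ : ∀ (c : Point n) {u v : Point n} → (∀ i → u i ≡ v i) → c · u ≡ c · v
·-congˡ {zero}  c eq = refl
·-congˡ {suc n} c eq = cong₂ _+_ (cong (c zero *_) (eq zero)) (·-congˡ (c ∘ suc) (eq ∘ suc))

·-zeroʳ : ∀ (c : Point n) → c · (λ _ → 0ℚ) ≡ 0ℚ
·-zeroʳ {zero}  c = refl
·-zeroʳ {suc n} c = trans (cong₂ _+_ (*-zeroʳ (c zero)) (·-zeroʳ (c ∘ suc))) (+-identityˡ 0ℚ)

·-distribˡ-+ : ∀ (c u v : Point n) → c · (λ i → u i + v i) ≡ c · u + c · v
·-distribˡ-+ {zero}  c u v = refl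
·-distribˡ-+ {suc n} c u v =
  trans (cong₂ _+_ (*-distribˡ-+ (c zero) (u zero) (v zero)) (·-distribˡ-+ (c ∘ suc) (u ∘ suc) (v ∘ suc)))
        (solve 4 (λ a b a′ b′ → (a :+ b) :+ (a′ :+ b′) := (a :+ a′) :+ (b :+ b′)) refl
           (c zero * u zero) (c zero * v zero) ((c ∘ suc) · (u ∘ suc)) ((c ∘ suc) · (v ∘ suc)))

·-scaleʳ : ∀ (c : Point n) k (u : Point n) → c · (λ i → k * u i) ≡ k * (c · u)
·-scaleʳ {zero}  c k u = sym (*-zeroʳ k)
·-scaleʳ {suc n} c k u =
  trans (cong₂ _+_ (solve 3 (λ c k u → c :* (k :* u) := k :* (c :* u)) refl (c zero) k (u zero))
                   (·-scaleʳ (c ∘ suc) k (u ∘ suc)))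
        (sym (*-distribˡ-+ k _ _))

χ-∈ : ∀ {B : Subset n} {i} → i ∈ B → χ B i ≡ 1ℚ
χ-∈ i∈B rewrite []=⇒lookup i∈B = refl

χ-∉ : ∀ {B : Subset n} {i} → i ∉ B → χ B i ≡ 0ℚ
χ-∉ {B = B} {i} i∉B with lookup B i in eq
... | true  = ⊥-elim (i∉B (lookup⇒[]= i B eq))
... | false = refl

0≤χ : ∀ (B : Subset n) i → 0ℚ ≤ χ B i
0≤χ B i with lookup B i
... | true  = 0≤1
... | false = ≤-refl

χ≤1 : ∀ (B : Subset n) i → χ B i ≤ 1ℚ
χ≤1 B i with lookup B i
... | true  = ≤-refl
... | false = 0≤1

χ-injective : ∀ {B B′ : Subset n} → (∀ i → χ B i ≡ χ B′ i) → B ≡ B′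
χ-injective {B = B} {B′} χ≡ = begin
  B                   ≡⟨ tabulate∘lookup B ⟨
  tabulate (lookup B)  ≡⟨ tabulate-cong (λ i → indicator-injective (χ≡ i)) ⟩
  tabulate (lookup B′) ≡⟨ tabulate∘lookup B′ ⟩
  B′                  ∎
  where
  open ≡-Reasoning
  indicator-injective : ∀ {b b′ : Bool} →
    (if b then 1ℚ else 0ℚ) ≡ (if b′ then 1ℚ else 0ℚ) → b ≡ b′
  indicator-injective {true}  {true}  _ = refl
  indicator-injective {false} {false} _ = refl
  indicator-injective {true}  {false} ()
  indicator-injective {false} {true}  ()

x∈p─q⁻ : ∀ (p q : Subset n) {x} → x ∈ p ─ q → x ∈ p × x ∉ q
x∈p─q⁻ (_      ∷ p) (_       ∷ q) (there x∈p─q) =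
  let x∈p , x∉q = x∈p─q⁻ p q x∈p─q in there x∈p , x∉q ∘ drop-there
x∈p─q⁻ (inside ∷ p) (outside ∷ q) here = here , λ ()

replace : Subset n → Fin n → Fin n → Subset n
replace B x y = (B - x) ∪ ⁅ y ⁆

∈-replace⁻ : ∀ {B : Subset n} {x y v} → v ∈ replace B x y → (v ∈ B × v ≢ x) ⊎ v ≡ y
∈-replace⁻ {B = B} {x} {y} v∈ with x∈p∪q⁻ (B - x) ⁅ y ⁆ v∈
... | inj₁ v∈B-x = let v∈B , v∉⁅x⁆ = x∈p─q⁻ B ⁅ x ⁆ v∈B-x in inj₁ (v∈B , x∉⁅y⁆⇒x≢y v∉⁅x⁆)
... | inj₂ v∈⁅y⁆ = inj₂ (x∈⁅y⁆⇒x≡y y v∈⁅y⁆)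

∈-replace⁺ : ∀ {B : Subset n} {x y v} → v ∈ B → v ≢ x → v ∈ replace B x y
∈-replace⁺ v∈B v≢x = x∈p∪q⁺ (inj₁ (x∈p∧x≢y⇒x∈p-y v∈B v≢x))

y∈replace : ∀ {B : Subset n} {x} y → y ∈ replace B x y
y∈replace y = x∈p∪q⁺ (inj₂ (x∈⁅x⁆ y))

∉-replace : ∀ {A : Subset n} {u z v} → v ∉ A → v ≢ z → v ∉ replace A u z
∉-replace v∉A v≢z v∈ with ∈-replace⁻ v∈
... | inj₁ (v∈A , _) = v∉A v∈A
... | inj₂ v≡z       = v≢z v≡z

χ-replace : ∀ {B : Subset n} {x y} → x ∈ B → y ∉ B → ∀ i →
            χ (replace B x y) i + χ ⁅ x ⁆ i ≡ χ B i + χ ⁅ y ⁆ i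
χ-replace {B = B} {x} {y} x∈B y∉B i with i ≟ x | i ≟ y
... | yes refl | yes refl = ⊥-elim (y∉B x∈B)
... | yes refl | no  x≢y  =
  trans (cong₂ _+_ (χ-∉ x∉replace) (χ-∈ (x∈⁅x⁆ x)))
        (sym (cong₂ _+_ (χ-∈ x∈B) (χ-∉ (x≢y⇒x∉⁅y⁆ x≢y))))
  where
  x∉replace : x ∉ replace B x y
  x∉replace x∈ with ∈-replace⁻ x∈
  ... | inj₁ (_ , x≢x) = x≢x refl
  ... | inj₂ x≡y       = x≢y x≡y
... | no  y≢x  | yes refl =
  trans (cong₂ _+_ (χ-∈ (y∈replace {B = B} y)) (χ-∉ (x≢y⇒x∉⁅y⁆ y≢x)))
        (sym (cong₂ _+_ (χ-∉ y∉B) (χ-∈ (x∈⁅x⁆ y))))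
... | no  i≢x  | no  i≢y  =
  cong₂ _+_ unchanged (trans (χ-∉ (x≢y⇒x∉⁅y⁆ i≢x)) (sym (χ-∉ (x≢y⇒x∉⁅y⁆ i≢y))))
  where
  unchanged : χ (replace B x y) i ≡ χ B i
  unchanged with i ∈? B
  ... | yes i∈B = trans (χ-∈ (∈-replace⁺ i∈B i≢x)) (sym (χ-∈ i∈B))
  ... | no  i∉B = trans (χ-∉ (∉-replace i∉B i≢y)) (sym (χ-∉ i∉B))

·-χ-replace : ∀ (c : Point n) {B x y} → x ∈ B → y ∉ B →
              c · χ (replace B x y) + c · χ ⁅ x ⁆ ≡ c · χ B + c · χ ⁅ y ⁆
·-χ-replace c {B} {x} {y} x∈B y∉B = begin
  c · χ (replace B x y) + c · χ ⁅ x ⁆          ≡⟨ ·-distribˡ-+ c _ _ ⟨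
  c · (λ i → χ (replace B x y) i + χ ⁅ x ⁆ i)  ≡⟨ ·-congˡ c (χ-replace x∈B y∉B) ⟩
  c · (λ i → χ B i + χ ⁅ y ⁆ i)                ≡⟨ ·-distribˡ-+ c _ _ ⟩
  c · χ B + c · χ ⁅ y ⁆                        ∎
  where open ≡-Reasoning

replace-─-⊆ : ∀ {A B : Subset n} {u z} → z ∈ B → replace A u z ─ B ⊆ A ─ B
replace-─-⊆ {A = A} {B} {u} {z} z∈B v∈ with x∈p─q⁻ (replace A u z) B v∈
... | v∈replace , v∉B with ∈-replace⁻ v∈replace
...   | inj₁ (v∈A , _) = x∈p∧x∉q⇒x∈p─q v∈A v∉B
...   | inj₂ refl      = ⊥-elim (v∉B z∈B)

replace-─-⊂ : ∀ {A B : Subset n} {u z} → u ∈ A → u ∉ B → z ∈ B → replace A u z ─ B ⊂ A ─ B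
replace-─-⊂ {A = A} {B} {u} {z} u∈A u∉B z∈B =
  replace-─-⊆ z∈B , u , x∈p∧x∉q⇒x∈p─q u∈A u∉B , u∉
  where
  u∉ : u ∉ replace A u z ─ B
  u∉ u∈ with ∈-replace⁻ (proj₁ (x∈p─q⁻ (replace A u z) B u∈))
  ... | inj₁ (_ , u≢u) = u≢u refl
  ... | inj₂ refl      = u∉B z∈B

Weighting : ℕ → Set
Weighting n = List (ℚ × Subset n)

combination : Weighting n → Point n
combination ws i = weighted proj₁ (λ p → χ (proj₂ p) i) ws

·-combination : ∀ (c : Point n) ws →
                c · combination ws ≡ weighted proj₁ (λ p → c · χ (proj₂ p)) ws
·-combination c []             = ·-zeroʳ c
·-combination c ((w , B) ∷ ws) = begin
  c · (λ i → w * χ B i + combination ws i)          ≡⟨ ·-distribˡ-+ c _ _ ⟩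
  c · (λ i → w * χ B i) + c · combination ws        ≡⟨ cong₂ _+_ (·-scaleʳ c w (χ B)) (·-combination c ws) ⟩
  w * (c · χ B) + weighted proj₁ (λ p → c · χ (proj₂ p)) ws ∎
  where open ≡-Reasoning

InQ-mono : ∀ {𝓑 𝓑′ : Family n} → (∀ {B} → 𝓑 B → 𝓑′ B) → ∀ {x} → InQ 𝓑 x → InQ 𝓑′ x
InQ-mono 𝓑⊆𝓑′ (ws , ws-in-𝓑 , Σw≡1 , x≡) = ws , All.map (map₂ 𝓑⊆𝓑′) ws-in-𝓑 , Σw≡1 , x≡

InQ⇒nonempty : ∀ {𝓑 : Family n} {x} → InQ 𝓑 x → ∃ 𝓑
InQ⇒nonempty (ws , ws-in-𝓑 , Σw≡1 , _) =
  let p , p∈ws , _ = positive-weight proj₁ ws (All.map proj₁ ws-in-𝓑) Σw≡1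
  in  proj₂ p , proj₂ (All.lookup ws-in-𝓑 p∈ws)

base⇒χ∈InQ : ∀ {𝓑 : Family n} {B} → 𝓑 B → InQ 𝓑 (χ B)
base⇒χ∈InQ {B = B} B∈𝓑 =
  (1ℚ , B) ∷ [] , (0≤1 , B∈𝓑) ∷ [] , refl , λ i → sym (trans (+-identityʳ _) (*-identityˡ _))

χ∈InQ⇒base : ∀ {𝓑 : Family n} {B} → InQ 𝓑 (χ B) → 𝓑 B
χ∈InQ⇒base {𝓑 = 𝓑} {B} (ws , ws-in-𝓑 , Σw≡1 , χ≡) =
  let (_ , B′) , p∈ws , 0<w = positive-weight proj₁ ws (All.map proj₁ ws-in-𝓑) Σw≡1
  in  subst 𝓑 (χ-injective λ i → All.lookup (coordinate i) p∈ws 0<w) (proj₂ (All.lookup ws-in-𝓑 p∈ws))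
  where
  coordinate : ∀ i → All (λ p → 0ℚ < proj₁ p → χ (proj₂ p) i ≡ χ B i) ws
  coordinate i with i ∈? B
  ... | yes i∈B rewrite χ-∈ i∈B =
    weighted-attains-max proj₁ (λ p → χ (proj₂ p) i) 1ℚ ws
      (All.map (λ {p} (0≤w , _) → 0≤w , χ≤1 (proj₂ p) i) ws-in-𝓑) Σw≡1 (trans (sym (χ≡ i)) (χ-∈ i∈B))
  ... | no  i∉B rewrite χ-∉ i∉B =
    weighted-attains-min proj₁ (λ p → χ (proj₂ p) i) 0ℚ ws
      (All.map (λ {p} (0≤w , _) → 0≤w , 0≤χ (proj₂ p) i) ws-in-𝓑) Σw≡1 (trans (sym (χ≡ i)) (χ-∉ i∉B))

drop-null-weights : ∀ {𝓑 P : Family n} (ws : Weighting n) → All (λ p → 0ℚ ≤ proj₁ p × 𝓑 (proj₂ p)) ws →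
  All (λ p → 0ℚ < proj₁ p → P (proj₂ p)) ws →
  ∃[ vs ] ( All (λ p → 0ℚ ≤ proj₁ p × (𝓑 ∩𝓑 P) (proj₂ p)) vs
          × Σˡ (map proj₁ vs) ≡ Σˡ (map proj₁ ws)
          × (∀ i → combination vs i ≡ combination ws i) )
drop-null-weights []             []                      []          = [] , [] , refl , λ _ → refl
drop-null-weights ((w , B) ∷ ws) ((0≤w , B∈𝓑) ∷ ws-in-𝓑) (P-B ∷ P-ws)
  with drop-null-weights ws ws-in-𝓑 P-ws | 0ℚ <? w
... | vs , vs-in , Σ≡ , comb≡ | yes 0<w =
  (w , B) ∷ vs , (0≤w , B∈𝓑 , P-B 0<w) ∷ vs-in , cong (w +_) Σ≡ , λ i → cong (w * χ B i +_) (comb≡ i)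
... | vs , vs-in , Σ≡ , comb≡ | no  0≮w =
  vs , vs-in , trans Σ≡ (sym (trans (cong (_+ _) w≡0) (+-identityˡ _))) ,
  λ i → trans (comb≡ i) (sym (null-term (χ B i) _))
  where
  w≡0 : w ≡ 0ℚ
  w≡0 = ≤-antisym (≮⇒≥ 0≮w) 0≤w
  null-term : ∀ t s → w * t + s ≡ s
  null-term t s = begin
    w * t + s   ≡⟨ cong (λ w → w * t + s) w≡0 ⟩
    0ℚ * t + s  ≡⟨ cong (_+ s) (*-zeroˡ t) ⟩
    0ℚ + s      ≡⟨ +-identityˡ s ⟩
    s           ∎
    where open ≡-Reasoning

InQ-face : ∀ {𝓑 : Family n} (c : Point n) d → (∀ B → 𝓑 B → c · χ B ≤ d) →
           ∀ {x} → InQ 𝓑 x → c · x ≡ d → InQ (λ B → 𝓑 B × c · χ B ≡ d) x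
InQ-face c d bounded {x} (ws , ws-in-𝓑 , Σw≡1 , x≡) cx≡d =
  let vs , vs-in , Σ≡ , comb≡ = drop-null-weights ws ws-in-𝓑 on-face
  in  vs , vs-in , trans Σ≡ Σw≡1 , λ i → trans (x≡ i) (sym (comb≡ i))
  where
  open ≡-Reasoning
  on-face : All (λ p → 0ℚ < proj₁ p → c · χ (proj₂ p) ≡ d) ws
  on-face = weighted-attains-max proj₁ (λ p → c · χ (proj₂ p)) d ws
    (All.map (λ {p} (0≤w , B∈𝓑) → 0≤w , bounded (proj₂ p) B∈𝓑) ws-in-𝓑) Σw≡1 (begin
      weighted proj₁ (λ p → c · χ (proj₂ p)) ws ≡⟨ ·-combination c ws ⟨
      c · combination ws                          ≡⟨ ·-congˡ c x≡ ⟨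
      c · x                                       ≡⟨ cx≡d ⟩
      d                                           ∎)

minimal-element : ∀ {P : Fin n → Set} → Decidable P → (f : Fin n → ℚ) →
                  ∀ {v} → P v → ∃[ u ] (P u × ∀ w → P w → f u ≤ f w)
minimal-element {n} P? f {v} Pv =
  argmin f v candidates ,
  argmin-all f Pv (all-filter P? (allFin n)) ,
  λ w Pw → All.lookup (f[argmin]≤f[xs] v candidates) (∈-filter⁺ P? (∈-allFin w) Pw)
  where
  candidates : List (Fin n)
  candidates = filter P? (allFin n)

IsMatroid-resp : ∀ {𝓑 𝓑′ : Family n} → (∀ B → 𝓑 B ⇔ 𝓑′ B) → IsMatroid 𝓑 → IsMatroid 𝓑′
IsMatroid-resp 𝓑⇔𝓑′ M = record
  { nonempty = map₂ (to (𝓑⇔𝓑′ _)) nonempty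
  ; exchange = λ B₁ B₂ B₁∈ B₂∈ x x∈B₁ x∉B₂ →
      map₂ (map₂ (map₂ (to (𝓑⇔𝓑′ _))))
        (exchange B₁ B₂ (from (𝓑⇔𝓑′ B₁) B₁∈) (from (𝓑⇔𝓑′ B₂) B₂∈) x x∈B₁ x∉B₂)
  }
  where
  open IsMatroid M
  open Equivalence

module MaximumWeightBases {𝓑 : Family n} (M : IsMatroid 𝓑) (c : Point n) (d : ℚ)
                          (bounded : ∀ B → 𝓑 B → c · χ B ≤ d) where

  open IsMatroid M

  weight : Subset n → ℚ
  weight B = c · χ B

  Optimal : Family n
  Optimal B = 𝓑 B × weight B ≡ d

  replace-weight : ∀ {A u z} → Optimal A → u ∈ A → z ∉ A →
                   weight (replace A u z) + weight ⁅ u ⁆ ≡ d + weight ⁅ z ⁆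
  replace-weight (_ , wA≡d) u∈A z∉A = trans (·-χ-replace c u∈A z∉A) (cong (_+ _) wA≡d)

  replace-lighter : ∀ {A u z} → Optimal A → 𝓑 (replace A u z) → u ∈ A → z ∉ A →
                    weight ⁅ z ⁆ ≤ weight ⁅ u ⁆
  replace-lighter {A} {u} {z} oA A′∈𝓑 u∈A z∉A = +-cancelˡ-≤ d (begin
    d + weight ⁅ z ⁆                     ≡⟨ replace-weight oA u∈A z∉A ⟨
    weight (replace A u z) + weight ⁅ u ⁆ ≤⟨ +-monoˡ-≤ _ (bounded _ A′∈𝓑) ⟩
    d + weight ⁅ u ⁆                     ∎)
    where open ≤-Reasoning

  replace-optimal : ∀ {A u z} → Optimal A → 𝓑 (replace A u z) → u ∈ A → z ∉ A →
                    weight ⁅ u ⁆ ≤ weight ⁅ z ⁆ → Optimal (replace A u z)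
  replace-optimal {A} {u} {z} oA A′∈𝓑 u∈A z∉A u≤z =
    A′∈𝓑 , ≤-antisym (bounded _ A′∈𝓑) (+-cancelʳ-≤ (weight ⁅ z ⁆) (begin
      d + weight ⁅ z ⁆                      ≡⟨ replace-weight oA u∈A z∉A ⟨
      weight (replace A u z) + weight ⁅ u ⁆ ≤⟨ +-monoʳ-≤ (weight (replace A u z)) u≤z ⟩
      weight (replace A u z) + weight ⁅ z ⁆ ∎))
    where open ≤-Reasoning

  step-toward : ∀ {A B u} → Optimal A → Optimal B → u ∈ A → u ∉ B →
                (∀ v → v ∈ A × v ∉ B → weight ⁅ u ⁆ ≤ weight ⁅ v ⁆) →
                ∃[ z ] (z ∈ B × z ∉ A × weight ⁅ z ⁆ ≤ weight ⁅ u ⁆ × Optimal (replace A u z))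
  step-toward {A} {B} {u} oA oB u∈A u∉B u-min =
    let z , z∈B , z∉A , A′∈𝓑 = exchange A B (proj₁ oA) (proj₁ oB) u u∈A u∉B
        t , t∈A , t∉B , B′∈𝓑 = exchange B A (proj₁ oB) (proj₁ oA) z z∈B z∉A
    in  z , z∈B , z∉A , replace-lighter oA A′∈𝓑 u∈A z∉A ,
        replace-optimal oA A′∈𝓑 u∈A z∉A
          (≤-trans (u-min t (t∈A , t∉B)) (replace-lighter oB B′∈𝓑 z∈B t∉B))

  -- If the partner y offered by the exchange axiom is too light, trade the lightest
  -- u ∈ A ∖ B for some z ∈ B: A - u + z is again optimal, closer to B, and avoids x
  -- because z is lighter than x.
  optimal-exchange : ∀ {B} A → Optimal B → Optimal A → ∀ {x} → x ∈ B → x ∉ A →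
                     Acc Data.Nat._<_ ∣ A ─ B ∣ → ∃[ y ] (y ∈ A × y ∉ B × Optimal (replace B x y))
  optimal-exchange {B} A oB oA {x} x∈B x∉A (acc closer)
    with exchange B A (proj₁ oB) (proj₁ oA) x x∈B x∉A
  ... | y , y∈A , y∉B , B′∈𝓑 with weight ⁅ x ⁆ ≤? weight ⁅ y ⁆
  ...   | yes x≤y = y , y∈A , y∉B , replace-optimal oB B′∈𝓑 x∈B y∉B x≤y
  ...   | no  x≰y
    with minimal-element (λ v → v ∈? A ×-dec ¬? (v ∈? B)) (λ v → weight ⁅ v ⁆) (y∈A , y∉B)
  ... | u , (u∈A , u∉B) , u-min with step-toward oA oB u∈A u∉B u-min
  ... | z , z∈B , z∉A , z≤u , oA′
    with optimal-exchange (replace A u z) oB oA′ x∈B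
           (∉-replace x∉A λ { refl → x≰y (≤-trans z≤u (u-min y (y∈A , y∉B))) })
           (closer (p⊂q⇒∣p∣<∣q∣ (replace-─-⊂ u∈A u∉B z∈B)))
  ... | y′ , y′∈A′ , y′∉B , oB′ =
    y′ , proj₁ (x∈p─q⁻ A B (replace-─-⊆ z∈B (x∈p∧x∉q⇒x∈p─q y′∈A′ y′∉B))) , y′∉B , oB′

  optimal-isMatroid : ∃ Optimal → IsMatroid Optimal
  optimal-isMatroid ∃optimal = record
    { nonempty = ∃optimal
    ; exchange = λ B A oB oA x x∈B x∉A → optimal-exchange A oB oA x∈B x∉A (<-wellFounded _)
    }

proposition7p3 : (n r : ℕ) (𝓑₁ 𝓑₂ : Family n) →
    IsMatroidOfRank r 𝓑₁ → IsMatroidOfRank r 𝓑₂ →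
    (∃[ x ] ((InQ 𝓑₁ ∩ᴾ InQ 𝓑₂) x)) →
    IsFace (InQ 𝓑₁ ∩ᴾ InQ 𝓑₂) (InQ 𝓑₁) →
    IsFace (InQ 𝓑₁ ∩ᴾ InQ 𝓑₂) (InQ 𝓑₂) →
    IsMatroidOfRank r (𝓑₁ ∩𝓑 𝓑₂) × (InQ (𝓑₁ ∩𝓑 𝓑₂) ≐ (InQ 𝓑₁ ∩ᴾ InQ 𝓑₂))
proposition7p3 n r 𝓑₁ 𝓑₂ (M₁ , rank₁) _ (_ , x₀∈Q₁ , x₀∈Q₂) (c , d , valid , face) _ =
  (IsMatroid-resp optimal⇔common (optimal-isMatroid (InQ⇒nonempty (on-face x₀∈Q₁ x₀∈Q₂))) ,
   λ B → rank₁ B ∘ proj₁) ,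
  λ x → (λ x∈Q → InQ-mono proj₁ x∈Q , InQ-mono proj₂ x∈Q) ,
        (λ (x∈Q₁ , x∈Q₂) → InQ-mono (to (optimal⇔common _)) (on-face x∈Q₁ x∈Q₂))
  where
  bounded : ∀ B → 𝓑₁ B → c · χ B ≤ d
  bounded B B∈𝓑₁ = valid (χ B) (base⇒χ∈InQ B∈𝓑₁)

  open MaximumWeightBases M₁ c d bounded
  open Equivalence

  on-face : ∀ {x} → InQ 𝓑₁ x → InQ 𝓑₂ x → InQ Optimal x
  on-face x∈Q₁ x∈Q₂ = InQ-face c d bounded x∈Q₁ (proj₂ (proj₁ (face _) (x∈Q₁ , x∈Q₂)))

  optimal⇔common : ∀ B → Optimal B ⇔ (𝓑₁ ∩𝓑 𝓑₂) B
  optimal⇔common B = mk⇔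
    (λ (B∈𝓑₁ , wB≡d) → B∈𝓑₁ , χ∈InQ⇒base (proj₂ (proj₂ (face (χ B)) (base⇒χ∈InQ B∈𝓑₁ , wB≡d))))
    (λ (B∈𝓑₁ , B∈𝓑₂) → B∈𝓑₁ , proj₂ (proj₁ (face (χ B)) (base⇒χ∈InQ B∈𝓑₁ , base⇒χ∈InQ B∈𝓑₂)))
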